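{- Let $u\in\Sigma_3^\omega$ be such that $f(u)$ is good, and suppose $u$ contains the factor $0110$. Then (1) $u$ has a suffix of the form $g(W)$ for some $W\in\Sigma_3^\omega$; and (2) a suffix of this $W$ has the form $h(U)$ for some $U\in\Sigma_3^\omega$.
   Context: $\Sigma_k=\{0,1,\dots,k-1\}$. The morphisms $f:\Sigma_3^*\to\Sigma_2^*$ and $g,h:\Sigma_3^*\to\Sigma_3^*$ are defined by $f(0)=0$, $f(1)=01$, $f(2)=011$; $g(0)=011$, $g(1)=0121$, $g(2)=012121$; $h(0)=01$, $h(1)=02$, $h(2)=022$ (extended to infinite words letterwise). A finite word of length $n$ is rich if it has $n$ distinct nonempty palindromic factors; an infinite word is rich if all of its finite factors are rich. A word is $\alpha$-free if it has no nonempty factor $x$ with $|x|/p\ge\alpha$ for some period $p$ of $x$. A word in $\Sigma_2^\omega$ is called good if it is rich and $14/5$-free. -}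

module Defs where

open import Data.Nat using (ℕ; zero; suc; _+_; _*_; _∸_; _≤_; _<_)
open import Data.Fin using (Fin; zero; suc)
open import Data.Fin.Properties using () renaming (_≟_ to _≟ᶠ_)
open import Data.List using (List; []; _∷_; map; concatMap; length; take; drop; reverse; filter; deduplicate; upTo; allFin)
open import Data.List.Properties using (≡-dec)
open import Data.Product using (_×_; ∃; _,_)
open import Relation.Binary.PropositionalEquality using (_≡_)
open import Relation.Nullary using (Dec; yes; no; ¬_)
open import Relation.Nullary.Decidable using (_×-dec_)
open import Data.Nat.Properties using (_≤?_)

Σ : ℕ → Set
Σ k = Fin k

Word : ℕ → Set
Word k = List (Σ k)

InfWord : ℕ → Set
InfWord k = ℕ → Σ k

factor : ∀ {k} → InfWord k → ℕ → ℕ → Word k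
factor w i n = map (λ j → w (i + j)) (upTo n)

suffix : ∀ {k} → InfWord k → ℕ → InfWord k
suffix w i n = w (i + n)

Morphism : ℕ → ℕ → Set
Morphism k l = Σ k → Word l

apply : ∀ {k l} → Morphism k l → Word k → Word l
apply φ x = concatMap φ x

-- v = φ(u) for infinite words u, v (φ non-erasing): for every n,
-- the image of the length-n prefix of u is a prefix of v.
IsImage : ∀ {k l} → Morphism k l → InfWord k → InfWord l → Set
IsImage φ u v = ∀ n → apply φ (factor u 0 n) ≡ factor v 0 (length (apply φ (factor u 0 n)))

𝟎 𝟏 𝟐 : ∀ {k} → Fin (suc (suc (suc k)))
𝟎 = zero
𝟏 = suc zero
𝟐 = suc (suc zero)

b0 b1 : Fin 2
b0 = zero
b1 = suc zero

f : Morphism 3 2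
f zero = b0 ∷ []
f (suc zero) = b0 ∷ b1 ∷ []
f (suc (suc zero)) = b0 ∷ b1 ∷ b1 ∷ []

g : Morphism 3 3
g zero = 𝟎 ∷ 𝟏 ∷ 𝟏 ∷ []
g (suc zero) = 𝟎 ∷ 𝟏 ∷ 𝟐 ∷ 𝟏 ∷ []
g (suc (suc zero)) = 𝟎 ∷ 𝟏 ∷ 𝟐 ∷ 𝟏 ∷ 𝟐 ∷ 𝟏 ∷ []

h : Morphism 3 3
h zero = 𝟎 ∷ 𝟏 ∷ []
h (suc zero) = 𝟎 ∷ 𝟐 ∷ []
h (suc (suc zero)) = 𝟎 ∷ 𝟐 ∷ 𝟐 ∷ []

_≟w_ : ∀ {k} (x y : Word k) → Dec (x ≡ y)
_≟w_ = ≡-dec _≟ᶠ_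

allFactors : ∀ {k} → Word k → List (Word k)
allFactors x = concatMap (λ i → map (λ l → take l (drop i x)) (upTo (suc (length x ∸ i)))) (upTo (suc (length x)))

IsNonemptyPalindrome : ∀ {k} → Word k → Set
IsNonemptyPalindrome x = (1 ≤ length x) × (reverse x ≡ x)

isNonemptyPalindrome? : ∀ {k} (x : Word k) → Dec (IsNonemptyPalindrome x)
isNonemptyPalindrome? x = (1 ≤? length x) ×-dec (reverse x ≟w x)

palFactors : ∀ {k} → Word k → List (Word k)
palFactors x = deduplicate _≟w_ (filter isNonemptyPalindrome? (allFactors x))

RichWord : ∀ {k} → Word k → Set
RichWord x = length (palFactors x) ≡ length x

Rich : ∀ {k} → InfWord k → Set
Rich w = ∀ i n → RichWord (factor w i n)

-- p is a period of the finite word x: p ≥ 1 and x[j] = x[j+p] whenever defined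
HasPeriod : ∀ {k} → Word k → ℕ → Set
HasPeriod x p = (1 ≤ p) × (drop p x ≡ take (length x ∸ p) x)

Free14/5 : ∀ {k} → InfWord k → Set
Free14/5 w = ∀ i n p → 1 ≤ n → HasPeriod (factor w i n) p → ¬ (14 * p ≤ 5 * n)

Good : InfWord 2 → Set
Good w = Rich w × Free14/5 w

Contains : ∀ {k} → InfWord k → Word k → Set
Contains w x = ∃ λ i → factor w i (length x) ≡ x

module Submission where

-- Every occurrence of 0110 in u is followed by g(h(c)) 0110 for some letter c: any other
-- continuation makes f(u) contain a factor that is not rich or has exponent at least 14/5.
-- This is a finite case analysis on the letters following the occurrence, carried out as a
-- certificate tree that is checked by evaluation. Iterating from the given occurrence parses that
-- suffix of u as g(h(U)), so W = h(U) and m = 0.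

open import Defs
open import Data.Empty using (⊥-elim)
open import Data.Fin using (Fin; zero; suc)
open import Data.List using (List; []; _∷_; _++_; [_]; length; take; drop; map; upTo; applyUpTo)
open import Data.List.Properties
  using (∷-injective; length-++; length-applyUpTo; length-take; length-drop; ++-identityʳ;
         take++drop≡id; map-cong; map-upTo; concatMap-++)
open import Data.Nat using (ℕ; zero; suc; _+_; _*_; _∸_; _≤_; _<_; z≤n; s≤s)
open import Data.Nat.Properties
  using (_≟_; _≤?_; +-suc; +-assoc; +-comm; +-identityʳ; +-mono-≤; ≤-trans; ≤-reflexive;
         ≤-total; m≤m+n; m+[n∸m]≡n; m+n∸m≡n; m≤n⇒m⊓n≡m; ∸-monoˡ-≤; suc-injective)
open import Data.Product using (_×_; _,_; proj₁; proj₂; ∃; Σ-syntax)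
open import Data.Sum using (inj₁; inj₂)
open import Data.Unit using (tt)
open import Relation.Binary.PropositionalEquality
  using (_≡_; refl; sym; trans; cong; cong₂; subst; module ≡-Reasoning)
open import Relation.Nullary using (Dec; ¬_; ¬?)
open import Relation.Nullary.Decidable using (_×-dec_; toWitness)

private variable
  k l m : ℕ
  A : Set

++-injective : ∀ (xs ys : List A) {xs′ ys′} → length xs ≡ length ys →
               xs ++ xs′ ≡ ys ++ ys′ → xs ≡ ys × xs′ ≡ ys′
++-injective []       []       _    eq = refl , eq
++-injective (x ∷ xs) (y ∷ ys) ∣eq∣ eq with ∷-injective eq
... | refl , eq′ with ++-injective xs ys (suc-injective ∣eq∣) eq′
...   | refl , eq″ = refl , eq″

slice : ℕ → ℕ → List A → List A
slice a b xs = take b (drop a xs)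

nth : A → List A → ℕ → A
nth d []       _       = d
nth d (x ∷ xs) zero    = x
nth d (x ∷ xs) (suc j) = nth d xs j

nth-++ˡ : ∀ {d : A} xs {ys j} → j < length xs → nth d (xs ++ ys) j ≡ nth d xs j
nth-++ˡ (x ∷ xs) {j = zero}  _        = refl
nth-++ˡ (x ∷ xs) {j = suc j} (s≤s j<) = nth-++ˡ xs j<

length-factor : ∀ (w : InfWord k) i n → length (factor w i n) ≡ n
length-factor w i n = trans (cong length (map-upTo _ n)) (length-applyUpTo _ n)

factor-suc : ∀ (w : InfWord k) i n → factor w i (suc n) ≡ w i ∷ factor w (suc i) n
factor-suc w i n = begin
  map (λ j → w (i + j)) (upTo (suc n))
    ≡⟨ map-upTo _ (suc n) ⟩
  w (i + 0) ∷ applyUpTo (λ j → w (i + suc j)) n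
    ≡⟨ cong₂ _∷_ (cong w (+-identityʳ i)) (sym (map-upTo _ n)) ⟩
  w i ∷ map (λ j → w (i + suc j)) (upTo n)
    ≡⟨ cong (w i ∷_) (map-cong (λ j → cong w (+-suc i j)) (upTo n)) ⟩
  w i ∷ factor w (suc i) n
    ∎
  where open ≡-Reasoning

factor-+ : ∀ (w : InfWord k) i m n → factor w i (m + n) ≡ factor w i m ++ factor w (i + m) n
factor-+ w i zero    n = cong (λ i′ → factor w i′ n) (sym (+-identityʳ i))
factor-+ w i (suc m) n = begin
  factor w i (suc m + n)
    ≡⟨ factor-suc w i (m + n) ⟩
  w i ∷ factor w (suc i) (m + n)
    ≡⟨ cong (w i ∷_) (factor-+ w (suc i) m n) ⟩
  w i ∷ factor w (suc i) m ++ factor w (suc i + m) n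
    ≡⟨ cong₂ (λ xs i′ → xs ++ factor w i′ n) (sym (factor-suc w i m)) (sym (+-suc i m)) ⟩
  factor w i (suc m) ++ factor w (i + suc m) n
    ∎
  where open ≡-Reasoning

OccursAt : InfWord k → ℕ → Word k → Set
OccursAt w i xs = factor w i (length xs) ≡ xs

occurs-++⁻ : ∀ (w : InfWord k) i xs {ys} → OccursAt w i (xs ++ ys) →
             OccursAt w i xs × OccursAt w (i + length xs) ys
occurs-++⁻ w i xs {ys} o = ++-injective _ xs (length-factor w i (length xs)) (begin
  factor w i (length xs) ++ factor w (i + length xs) (length ys)
    ≡⟨ factor-+ w i (length xs) (length ys) ⟨
  factor w i (length xs + length ys)
    ≡⟨ cong (factor w i) (length-++ xs) ⟨
  factor w i (length (xs ++ ys))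
    ≡⟨ o ⟩
  xs ++ ys
    ∎)
  where open ≡-Reasoning

occurs-++⁺ : ∀ (w : InfWord k) i xs {ys} → OccursAt w i xs → OccursAt w (i + length xs) ys →
             OccursAt w i (xs ++ ys)
occurs-++⁺ w i xs {ys} oxs oys = begin
  factor w i (length (xs ++ ys))
    ≡⟨ cong (factor w i) (length-++ xs) ⟩
  factor w i (length xs + length ys)
    ≡⟨ factor-+ w i (length xs) (length ys) ⟩
  factor w i (length xs) ++ factor w (i + length xs) (length ys)
    ≡⟨ cong₂ _++_ oxs oys ⟩
  xs ++ ys
    ∎
  where open ≡-Reasoning

occurs-take : ∀ (w : InfWord k) i n xs → OccursAt w i xs → OccursAt w i (take n xs)
occurs-take w i n xs o =
  proj₁ (occurs-++⁻ w i (take n xs) (subst (OccursAt w i) (sym (take++drop≡id n xs)) o))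

occurs-drop : ∀ (w : InfWord k) i n xs → n ≤ length xs → OccursAt w i xs →
              OccursAt w (i + n) (drop n xs)
occurs-drop w i n xs n≤ o =
  subst (λ n′ → OccursAt w (i + n′) (drop n xs)) (trans (length-take n xs) (m≤n⇒m⊓n≡m n≤))
    (proj₂ (occurs-++⁻ w i (take n xs) (subst (OccursAt w i) (sym (take++drop≡id n xs)) o)))

occurs-slice : ∀ (w : InfWord k) i a b xs → a + b ≤ length xs → OccursAt w i xs →
               factor w (i + a) b ≡ slice a b xs
occurs-slice w i a b xs a+b≤ o =
  subst (λ b′ → factor w (i + a) b′ ≡ slice a b xs) ∣slice∣≡b
    (occurs-take w (i + a) b (drop a xs) (occurs-drop w i a xs (≤-trans (m≤m+n a b) a+b≤) o))
  where
  b≤∣drop∣ : b ≤ length (drop a xs)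
  b≤∣drop∣ = subst (b ≤_) (sym (length-drop a xs))
    (≤-trans (≤-reflexive (sym (m+n∸m≡n a b))) (∸-monoˡ-≤ a a+b≤))
  ∣slice∣≡b : length (slice a b xs) ≡ b
  ∣slice∣≡b = trans (length-take b (drop a xs)) (m≤n⇒m⊓n≡m b≤∣drop∣)

occurs-snoc : ∀ (w : InfWord k) i xs → OccursAt w i xs →
              OccursAt w i (xs ++ [ w (i + length xs) ])
occurs-snoc w i xs o = occurs-++⁺ w i xs o (factor-suc w (i + length xs) 0)

nth⇒occurs : ∀ {d} (w : InfWord k) i xs → (∀ j → j < length xs → w (i + j) ≡ nth d xs j) →
             OccursAt w i xs
nth⇒occurs w i []       _    = refl
nth⇒occurs w i (x ∷ xs) w≡xs = trans (factor-suc w i (length xs)) (cong₂ _∷_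
  (trans (cong w (sym (+-identityʳ i))) (w≡xs 0 (s≤s z≤n)))
  (nth⇒occurs w (suc i) xs (λ j j< → trans (cong w (sym (+-suc i j))) (w≡xs (suc j) (s≤s j<)))))

_∘ᵐ_ : Morphism l m → Morphism k l → Morphism k m
(φ ∘ᵐ ψ) c = apply φ (ψ c)

apply-∘ᵐ : ∀ (φ : Morphism l m) (ψ : Morphism k l) xs →
           apply φ (apply ψ xs) ≡ apply (φ ∘ᵐ ψ) xs
apply-∘ᵐ φ ψ []       = refl
apply-∘ᵐ φ ψ (c ∷ xs) =
  trans (concatMap-++ φ (ψ c) (apply ψ xs)) (cong (apply φ (ψ c) ++_) (apply-∘ᵐ φ ψ xs))

apply-factor-+ : ∀ (φ : Morphism k l) (u : InfWord k) i m n →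
                 apply φ (factor u i (m + n)) ≡
                 apply φ (factor u i m) ++ apply φ (factor u (i + m) n)
apply-factor-+ φ u i m n =
  trans (cong (apply φ) (factor-+ u i m n)) (concatMap-++ φ (factor u i m) _)

apply-factor-suc : ∀ (φ : Morphism k l) (u : InfWord k) i n →
                   apply φ (factor u i (suc n)) ≡ apply φ (factor u i n) ++ φ (u (i + n))
apply-factor-suc φ u i n = begin
  apply φ (factor u i (suc n))
    ≡⟨ cong (λ n′ → apply φ (factor u i n′)) (+-comm 1 n) ⟩
  apply φ (factor u i (n + 1))
    ≡⟨ apply-factor-+ φ u i n 1 ⟩
  apply φ (factor u i n) ++ φ (u (i + n + 0)) ++ []
    ≡⟨ cong (λ j → apply φ (factor u i n) ++ φ (u j) ++ []) (+-identityʳ (i + n)) ⟩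
  apply φ (factor u i n) ++ φ (u (i + n)) ++ []
    ≡⟨ cong (apply φ (factor u i n) ++_) (++-identityʳ (φ (u (i + n)))) ⟩
  apply φ (factor u i n) ++ φ (u (i + n))
    ∎
  where open ≡-Reasoning

NonErasing : Morphism k l → Set
NonErasing φ = ∀ c → 1 ≤ length (φ c)

length-apply : ∀ (φ : Morphism k l) → NonErasing φ → ∀ xs → length xs ≤ length (apply φ xs)
length-apply φ ne []       = z≤n
length-apply φ ne (c ∷ xs) =
  ≤-trans (+-mono-≤ (ne c) (length-apply φ ne xs)) (≤-reflexive (sym (length-++ (φ c))))

length-apply-factor : ∀ (φ : Morphism k l) → NonErasing φ → ∀ u i n →
                      n ≤ length (apply φ (factor u i n))
length-apply-factor φ ne u i n =
  subst (_≤ length (apply φ (factor u i n))) (length-factor u i n) (length-apply φ ne (factor u i n))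

isImage⇒occurs : ∀ {φ : Morphism k l} {u v} → IsImage φ u v → ∀ n →
                 OccursAt v 0 (apply φ (factor u 0 n))
isImage⇒occurs img n = sym (img n)

image-occurs : ∀ {φ : Morphism k l} {u v} → IsImage φ u v → ∀ q x → OccursAt u q x →
               OccursAt v (length (apply φ (factor u 0 q))) (apply φ x)
image-occurs {φ = φ} {u} {v} img q x o = proj₂ (occurs-++⁻ v 0 (apply φ (factor u 0 q))
  (subst (OccursAt v 0) prefix≡ (isImage⇒occurs img (q + length x))))
  where
  prefix≡ : apply φ (factor u 0 (q + length x)) ≡ apply φ (factor u 0 q) ++ apply φ x
  prefix≡ = trans (apply-factor-+ φ u 0 q (length x))
                  (cong (λ y → apply φ (factor u 0 q) ++ apply φ y) o)

image-slice : ∀ {φ : Morphism k l} {u v} → IsImage φ u v → ∀ q x a b →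
              a + b ≤ length (apply φ x) → OccursAt u q x →
              factor v (length (apply φ (factor u 0 q)) + a) b ≡ slice a b (apply φ x)
image-slice {φ = φ} {u} {v} img q x a b fits o =
  occurs-slice v (length (apply φ (factor u 0 q))) a b (apply φ x) fits (image-occurs img q x o)

-- For non-erasing φ the image of the first n + 1 letters has more than n letters, so the
-- default letter of nth is never reached.
image : Morphism k (suc l) → InfWord k → InfWord (suc l)
image φ u n = nth zero (apply φ (factor u 0 (suc n))) n

nth-apply-factor : ∀ (φ : Morphism k (suc l)) u {m n} j → m ≤ n →
                   j < length (apply φ (factor u 0 m)) →
                   nth zero (apply φ (factor u 0 n)) j ≡ nth zero (apply φ (factor u 0 m)) j
nth-apply-factor φ u {m} {n} j m≤n j< = begin
  nth zero (apply φ (factor u 0 n)) j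
    ≡⟨ cong (λ n′ → nth zero (apply φ (factor u 0 n′)) j) (m+[n∸m]≡n m≤n) ⟨
  nth zero (apply φ (factor u 0 (m + (n ∸ m)))) j
    ≡⟨ cong (λ y → nth zero y j) (apply-factor-+ φ u 0 m (n ∸ m)) ⟩
  nth zero (apply φ (factor u 0 m) ++ apply φ (factor u m (n ∸ m))) j
    ≡⟨ nth-++ˡ (apply φ (factor u 0 m)) j< ⟩
  nth zero (apply φ (factor u 0 m)) j
    ∎
  where open ≡-Reasoning

image-nth : ∀ (φ : Morphism k (suc l)) → NonErasing φ → ∀ u n j →
            j < length (apply φ (factor u 0 n)) →
            image φ u j ≡ nth zero (apply φ (factor u 0 n)) j
image-nth φ ne u n j j< with ≤-total (suc j) n
... | inj₁ j<n = sym (nth-apply-factor φ u j j<n (length-apply-factor φ ne u 0 (suc j)))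
... | inj₂ n≤j = nth-apply-factor φ u j n≤j j<

image-isImage : ∀ (φ : Morphism k (suc l)) → NonErasing φ → ∀ u → IsImage φ u (image φ u)
image-isImage φ ne u n =
  sym (nth⇒occurs (image φ u) 0 (apply φ (factor u 0 n)) (image-nth φ ne u n))

isImage-∘ᵐ : ∀ (φ : Morphism (suc l) m) (ψ : Morphism k (suc l)) → NonErasing ψ → ∀ {u v} →
             IsImage (φ ∘ᵐ ψ) u v → IsImage φ (image ψ u) v
isImage-∘ᵐ φ ψ ne {u} {v} img n = sym (proj₁ (occurs-++⁻ v 0 (apply φ (factor w 0 n))
  (subst (OccursAt v 0) φψ≡ (isImage⇒occurs img n))))
  where
  w = image ψ u
  y = apply ψ (factor u 0 n)
  y≡ : y ≡ factor w 0 n ++ factor w n (length y ∸ n)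
  y≡ = begin
    y
      ≡⟨ isImage⇒occurs (image-isImage ψ ne u) n ⟨
    factor w 0 (length y)
      ≡⟨ cong (factor w 0) (m+[n∸m]≡n (length-apply-factor ψ ne u 0 n)) ⟨
    factor w 0 (n + (length y ∸ n))
      ≡⟨ factor-+ w 0 n (length y ∸ n) ⟩
    factor w 0 n ++ factor w n (length y ∸ n)
      ∎
    where open ≡-Reasoning
  φψ≡ : apply (φ ∘ᵐ ψ) (factor u 0 n) ≡ apply φ (factor w 0 n) ++ apply φ (factor w n (length y ∸ n))
  φψ≡ = trans (sym (apply-∘ᵐ φ ψ (factor u 0 n)))
              (trans (cong (apply φ) y≡) (concatMap-++ φ (factor w 0 n) _))

module _ (ψ : Morphism k l) (v : InfWord l) (z : Word l)
         (next : ∀ q → OccursAt v q z → Σ[ c ∈ Fin k ] OccursAt v q (ψ c ++ z)) where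

  returns⇒suffix-isImage : ∀ i → OccursAt v i z → Σ[ u ∈ InfWord k ] IsImage ψ u (suffix v i)
  returns⇒suffix-isImage i start = u , λ n → sym (prefix-occurs n)
    where
    Occurrence : Set
    Occurrence = Σ[ q ∈ ℕ ] OccursAt v q z

    letter : Occurrence → Fin k
    letter (q , o) = proj₁ (next q o)

    split : ((q , o) : Occurrence) →
            OccursAt v q (ψ (letter (q , o))) × OccursAt v (q + length (ψ (letter (q , o)))) z
    split (q , o) = occurs-++⁻ v q (ψ (letter (q , o))) (proj₂ (next q o))

    successor : Occurrence → Occurrence
    successor (q , o) = q + length (ψ (letter (q , o))) , proj₂ (split (q , o))

    occurrence : ℕ → Occurrence
    occurrence zero    = i , start
    occurrence (suc n) = successor (occurrence n)

    u : InfWord k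
    u n = letter (occurrence n)

    position : ∀ n → proj₁ (occurrence n) ≡ i + length (apply ψ (factor u 0 n))
    position zero    = sym (+-identityʳ i)
    position (suc n) = begin
      proj₁ (occurrence n) + length (ψ (u n))
        ≡⟨ cong (_+ length (ψ (u n))) (position n) ⟩
      i + length (apply ψ (factor u 0 n)) + length (ψ (u n))
        ≡⟨ +-assoc i _ _ ⟩
      i + (length (apply ψ (factor u 0 n)) + length (ψ (u n)))
        ≡⟨ cong (i +_) (length-++ (apply ψ (factor u 0 n))) ⟨
      i + length (apply ψ (factor u 0 n) ++ ψ (u n))
        ≡⟨ cong (λ ys → i + length ys) (apply-factor-suc ψ u 0 n) ⟨
      i + length (apply ψ (factor u 0 (suc n)))
        ∎
      where open ≡-Reasoning

    prefix-occurs : ∀ n → OccursAt v i (apply ψ (factor u 0 n))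
    prefix-occurs zero    = refl
    prefix-occurs (suc n) = subst (OccursAt v i) (sym (apply-factor-suc ψ u 0 n))
      (occurs-++⁺ v i (apply ψ (factor u 0 n)) (prefix-occurs n)
        (subst (λ q → OccursAt v q (ψ (u n))) (position n) (proj₁ (split (occurrence n)))))

-- A leaf
-- returns c asserts that x begins with ψ(c) z; nonRich a b and periodic a b p name the factor
-- of φ(x) at offset a of length b that is not rich, resp. has period p and exponent ≥ 14/5,
-- so that x cannot occur in u.
data Certificate : Set where
  nonRich  : (a b : ℕ) → Certificate
  periodic : (a b p : ℕ) → Certificate
  returns  : Fin 3 → Certificate
  branch   : Certificate → Certificate → Certificate → Certificate

uniform : Certificate → Certificate
uniform t = branch t t t

module _ (φ : Morphism 3 l) (ψ : Morphism 3 3) (z : Word 3) where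

  Valid : Word 3 → Certificate → Set
  Valid x (nonRich a b)     = a + b ≤ length (apply φ x) × ¬ RichWord (slice a b (apply φ x))
  Valid x (periodic a b p)  = a + b ≤ length (apply φ x) × 1 ≤ b ×
                              HasPeriod (slice a b (apply φ x)) p × 14 * p ≤ 5 * b
  Valid x (returns c)       = take (length (ψ c ++ z)) x ≡ ψ c ++ z
  Valid x (branch t₀ t₁ t₂) =
    Valid (x ++ [ 𝟎 ]) t₀ × Valid (x ++ [ 𝟏 ]) t₁ × Valid (x ++ [ 𝟐 ]) t₂

  valid? : ∀ x t → Dec (Valid x t)
  valid? x (nonRich a b)     =
    a + b ≤? length (apply φ x) ×-dec ¬? (length (palFactors s) ≟ length s)
    where s = slice a b (apply φ x)
  valid? x (periodic a b p)  =
    a + b ≤? length (apply φ x) ×-dec 1 ≤? b ×-dec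
    (1 ≤? p ×-dec (drop p s ≟w take (length s ∸ p) s)) ×-dec 14 * p ≤? 5 * b
    where s = slice a b (apply φ x)
  valid? x (returns c)       = take (length (ψ c ++ z)) x ≟w (ψ c ++ z)
  valid? x (branch t₀ t₁ t₂) =
    valid? (x ++ [ 𝟎 ]) t₀ ×-dec valid? (x ++ [ 𝟏 ]) t₁ ×-dec valid? (x ++ [ 𝟐 ]) t₂

  module _ {u : InfWord 3} {v : InfWord l} (img : IsImage φ u v)
           (rich : Rich v) (free : Free14/5 v) where

    valid⇒returns : ∀ x t → Valid x t → ∀ q → OccursAt u q x →
                    Σ[ c ∈ Fin 3 ] OccursAt u q (ψ c ++ z)
    valid⇒returns x (nonRich a b) (fits , nonrich) q o =
      ⊥-elim (nonrich (subst RichWord (image-slice img q x a b fits o) (rich _ b)))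
    valid⇒returns x (periodic a b p) (fits , 1≤b , period , 14p≤5b) q o =
      ⊥-elim (free _ b p 1≤b
        (subst (λ y → HasPeriod y p) (sym (image-slice img q x a b fits o)) period) 14p≤5b)
    valid⇒returns x (returns c) prefix q o =
      c , subst (OccursAt u q) prefix (occurs-take u q _ x o)
    valid⇒returns x (branch t₀ t₁ t₂) (v₀ , v₁ , v₂) q o =
      extend (u (q + length x)) (occurs-snoc u q x o)
      where
      extend : ∀ a → OccursAt u q (x ++ [ a ]) → Σ[ c ∈ Fin 3 ] OccursAt u q (ψ c ++ z)
      extend zero             = valid⇒returns _ t₀ v₀ q
      extend (suc zero)       = valid⇒returns _ t₁ v₁ q
      extend (suc (suc zero)) = valid⇒returns _ t₂ v₂ q

𝟎𝟏𝟏𝟎 : Word 3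
𝟎𝟏𝟏𝟎 = 𝟎 ∷ 𝟏 ∷ 𝟏 ∷ 𝟎 ∷ []

h-nonErasing : NonErasing h
h-nonErasing zero             = s≤s z≤n
h-nonErasing (suc zero)       = s≤s z≤n
h-nonErasing (suc (suc zero)) = s≤s z≤n

certificate : Certificate
certificate =
  branch (uniform (periodic 5 3 1)) (branch (branch (uniform (periodic 8 3 1))
  (uniform (periodic 3 9 3)) (branch (branch (uniform (periodic 12 3 1)) (branch (branch
  (uniform (periodic 15 3 1)) (branch (uniform (periodic 11 9 3)) (branch (branch
  (uniform (periodic 20 3 1)) (branch (branch (uniform (periodic 23 3 1))
  (uniform (periodic 18 9 3)) (branch (branch (uniform (periodic 27 3 1)) (branch (branch
  (uniform (periodic 30 3 1)) (branch (uniform (periodic 26 9 3)) (branch (branch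
  (uniform (periodic 35 3 1)) (branch (branch (uniform (periodic 38 3 1))
  (uniform (periodic 33 9 3)) (periodic 0 42 15)) (branch (uniform (periodic 28 14 5))
  (periodic 36 6 2) (periodic 36 6 2)) (nonRich 25 16)) (nonRich 25 14)) (periodic 31 6 2)
  (periodic 31 6 2)) (nonRich 25 11)) (branch (branch (uniform (periodic 34 3 1)) (branch
  (uniform (periodic 19 20 7)) (nonRich 17 22) (nonRich 32 8)) (branch (branch
  (uniform (periodic 38 3 1)) (periodic 29 12 4) (periodic 29 12 4)) (nonRich 17 23)
  (nonRich 17 23))) (nonRich 17 19) (nonRich 17 19))) (nonRich 17 15) (nonRich 25 8)) (branch
  (branch (uniform (periodic 31 3 1)) (periodic 22 12 4) (periodic 22 12 4)) (nonRich 17 16)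
  (nonRich 17 16))) (nonRich 17 12) (nonRich 17 12))) (branch (uniform (periodic 13 14 5))
  (periodic 21 6 2) (periodic 21 6 2)) (nonRich 10 16)) (nonRich 10 14)) (periodic 16 6 2)
  (periodic 16 6 2)) (nonRich 10 11)) (branch (branch (uniform (periodic 19 3 1)) (branch
  (uniform (periodic 4 20 7)) (nonRich 2 22) (nonRich 17 8)) (branch (branch
  (uniform (periodic 23 3 1)) (periodic 14 12 4) (periodic 14 12 4)) (nonRich 2 23)
  (nonRich 2 23))) (nonRich 2 19) (nonRich 2 19))) (nonRich 2 15) (nonRich 10 8)) (branch (branch
  (uniform (periodic 16 3 1)) (periodic 7 12 4) (periodic 7 12 4)) (nonRich 2 16) (nonRich 2 16)))
  (nonRich 2 12) (nonRich 2 12))) (branch (branch (uniform (periodic 10 3 1))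
  (uniform (periodic 0 14 5)) (branch (branch (uniform (periodic 14 3 1)) (branch (branch
  (uniform (periodic 17 3 1)) (branch (nonRich 3 18) (nonRich 7 15) (nonRich 12 11)) (branch
  (branch (uniform (periodic 21 3 1)) (branch (branch (uniform (periodic 24 3 1)) (branch
  (nonRich 3 25) (nonRich 7 22) (nonRich 19 11)) (periodic 8 20 7)) (branch (branch
  (uniform (periodic 26 3 1)) (branch (branch (nonRich 14 17) (nonRich 14 17) (nonRich 19 14))
  (branch (branch (uniform (periodic 31 3 1)) (periodic 20 14 5) (periodic 20 14 5))
  (periodic 27 6 2) (periodic 27 6 2)) (nonRich 19 13)) (branch (branch (uniform (periodic 30 3 1))
  (branch (branch (uniform (periodic 33 3 1)) (branch (nonRich 3 34) (nonRich 23 15)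
  (nonRich 28 11)) (branch (branch (uniform (periodic 37 3 1)) (branch (branch
  (uniform (periodic 40 3 1)) (branch (nonRich 3 41) (nonRich 23 22) (nonRich 35 11))
  (periodic 24 20 7)) (branch (branch (uniform (periodic 42 3 1)) (branch (branch (nonRich 30 17)
  (nonRich 30 17) (nonRich 35 14)) (branch (branch (uniform (periodic 47 3 1)) (periodic 36 14 5)
  (periodic 36 14 5)) (periodic 43 6 2) (periodic 43 6 2)) (nonRich 35 13)) (branch (branch
  (uniform (periodic 46 3 1)) (periodic 4 45 16) (periodic 4 45 16)) (nonRich 39 9)
  (nonRich 39 9))) (periodic 38 6 2) (periodic 38 6 2)) (nonRich 35 8)) (branch (branch
  (uniform (periodic 41 3 1)) (periodic 32 12 4) (periodic 32 12 4)) (nonRich 23 20)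
  (nonRich 23 20))) (nonRich 23 16) (nonRich 23 16))) (branch (branch (uniform (periodic 35 3 1))
  (branch (nonRich 3 36) (nonRich 3 36) (nonRich 28 13)) (branch (uniform (periodic 15 26 9))
  (nonRich 32 9) (nonRich 32 9))) (periodic 31 6 2) (periodic 31 6 2)) (nonRich 28 8)) (branch
  (branch (uniform (periodic 34 3 1)) (periodic 25 12 4) (periodic 25 12 4)) (nonRich 23 13)
  (nonRich 23 13))) (nonRich 23 9) (nonRich 23 9))) (periodic 22 6 2) (periodic 22 6 2))
  (nonRich 19 8)) (branch (branch (uniform (periodic 25 3 1)) (periodic 16 12 4)
  (periodic 16 12 4)) (nonRich 7 20) (nonRich 7 20))) (nonRich 7 16) (nonRich 7 16))) (branch
  (branch (uniform (periodic 19 3 1)) (branch (branch (uniform (periodic 22 3 1))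
  (uniform (periodic 17 9 3)) (nonRich 12 14)) (branch (branch (uniform (periodic 24 3 1))
  (periodic 13 14 5) (periodic 13 14 5)) (periodic 20 6 2) (periodic 20 6 2)) (nonRich 12 13))
  (branch (branch (uniform (periodic 23 3 1)) (branch (branch (uniform (periodic 26 3 1)) (branch
  (nonRich 3 27) (nonRich 16 15) (nonRich 21 11)) (branch (branch (uniform (periodic 30 3 1))
  (branch (branch (uniform (periodic 33 3 1)) (branch (nonRich 3 34) (nonRich 16 22)
  (nonRich 28 11)) (periodic 17 20 7)) (branch (branch (uniform (periodic 35 3 1)) (branch
  (nonRich 3 36) (nonRich 3 36) (nonRich 28 13)) (branch (branch (uniform (periodic 39 3 1))
  (branch (branch (uniform (periodic 42 3 1)) (branch (nonRich 3 43) (nonRich 32 15)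
  (nonRich 37 11)) (branch (branch (uniform (periodic 46 3 1)) (branch (branch
  (uniform (periodic 49 3 1)) (branch (nonRich 3 50) (nonRich 32 22) (nonRich 44 11))
  (periodic 33 20 7)) (branch (uniform (periodic 8 45 16)) (periodic 47 6 2) (periodic 47 6 2))
  (nonRich 44 8)) (branch (branch (uniform (periodic 50 3 1)) (periodic 41 12 4)
  (periodic 41 12 4)) (nonRich 32 20) (nonRich 32 20))) (nonRich 32 16) (nonRich 32 16))) (branch
  (branch (uniform (periodic 44 3 1)) (branch (branch (nonRich 23 26) (nonRich 23 26)
  (nonRich 37 14)) (branch (branch (uniform (periodic 49 3 1)) (periodic 38 14 5)
  (periodic 38 14 5)) (periodic 45 6 2) (periodic 45 6 2)) (nonRich 37 13)) (branch
  (uniform (periodic 24 26 9)) (nonRich 41 9) (nonRich 41 9))) (periodic 40 6 2) (periodic 40 6 2))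
  (nonRich 37 8)) (branch (branch (uniform (periodic 43 3 1)) (periodic 34 12 4)
  (periodic 34 12 4)) (nonRich 32 13) (nonRich 32 13))) (nonRich 32 9) (nonRich 32 9)))
  (periodic 31 6 2) (periodic 31 6 2)) (nonRich 28 8)) (branch (branch (uniform (periodic 34 3 1))
  (periodic 25 12 4) (periodic 25 12 4)) (nonRich 16 20) (nonRich 16 20))) (nonRich 16 16)
  (nonRich 16 16))) (branch (uniform (periodic 4 26 9)) (periodic 24 6 2) (periodic 24 6 2))
  (nonRich 21 8)) (branch (branch (uniform (periodic 27 3 1)) (periodic 18 12 4)
  (periodic 18 12 4)) (nonRich 16 13) (nonRich 16 13))) (nonRich 16 9) (nonRich 16 9)))
  (periodic 15 6 2) (periodic 15 6 2)) (nonRich 12 8)) (branch (branch (uniform (periodic 18 3 1))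
  (periodic 9 12 4) (periodic 9 12 4)) (nonRich 7 13) (nonRich 7 13))) (nonRich 7 9)
  (nonRich 7 9))) (periodic 6 6 2) (periodic 6 6 2)) (branch (uniform (nonRich 5 8)) (branch
  (branch (uniform (periodic 13 3 1)) (branch (branch (uniform (periodic 16 3 1))
  (uniform (periodic 11 9 3)) (nonRich 9 11)) (branch (returns 𝟎) (periodic 14 6 2)
  (periodic 14 6 2)) (branch (uniform (nonRich 13 8)) (branch (branch (uniform (periodic 21 3 1))
  (uniform (periodic 2 23 8)) (nonRich 17 8)) (uniform (periodic 18 6 2)) (branch
  (uniform (nonRich 13 13)) (branch (branch (uniform (periodic 26 3 1)) (branch (branch
  (uniform (periodic 29 3 1)) (uniform (periodic 24 9 3)) (nonRich 22 11)) (branch (nonRich 1 31)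
  (periodic 27 6 2) (periodic 27 6 2)) (branch (uniform (nonRich 26 8)) (branch (branch
  (uniform (periodic 34 3 1)) (branch (branch (uniform (periodic 37 3 1))
  (uniform (periodic 32 9 3)) (nonRich 30 11)) (branch (branch (uniform (periodic 39 3 1)) (branch
  (branch (uniform (periodic 42 3 1)) (uniform (periodic 37 9 3)) (nonRich 30 16)) (branch
  (periodic 31 14 5) (periodic 40 6 2) (periodic 40 6 2)) (branch (uniform (nonRich 39 8)) (branch
  (branch (uniform (periodic 47 3 1)) (branch (branch (uniform (periodic 50 3 1))
  (uniform (periodic 45 9 3)) (nonRich 43 11)) (branch (branch (uniform (periodic 52 3 1)) (branch
  (branch (uniform (periodic 55 3 1)) (uniform (periodic 50 9 3)) (nonRich 43 16)) (branch
  (periodic 44 14 5) (periodic 53 6 2) (periodic 53 6 2)) (branch (uniform (nonRich 52 8))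
  (periodic 23 37 13) (periodic 23 37 13))) (nonRich 43 13)) (periodic 48 6 2) (periodic 48 6 2))
  (branch (uniform (nonRich 47 8)) (branch (branch (uniform (periodic 55 3 1))
  (uniform (periodic 36 23 8)) (nonRich 51 8)) (uniform (periodic 52 6 2)) (branch
  (uniform (nonRich 47 13)) (branch (branch (uniform (periodic 60 3 1)) (branch (branch
  (uniform (periodic 63 3 1)) (uniform (periodic 58 9 3)) (nonRich 56 11)) (branch (nonRich 35 31)
  (periodic 61 6 2) (periodic 61 6 2)) (branch (uniform (nonRich 60 8)) (branch (branch
  (uniform (periodic 68 3 1)) (branch (branch (uniform (periodic 71 3 1))
  (uniform (periodic 66 9 3)) (nonRich 64 11)) (branch (branch (uniform (periodic 73 3 1)) (branch
  (branch (uniform (periodic 76 3 1)) (uniform (periodic 71 9 3)) (nonRich 64 16)) (branch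
  (periodic 65 14 5) (periodic 74 6 2) (periodic 74 6 2)) (branch (uniform (nonRich 73 8)) (branch
  (branch (uniform (periodic 81 3 1)) (branch (branch (uniform (periodic 84 3 1))
  (uniform (periodic 79 9 3)) (nonRich 77 11)) (branch (branch (uniform (periodic 86 3 1)) (branch
  (branch (uniform (periodic 89 3 1)) (uniform (periodic 84 9 3)) (nonRich 77 16)) (branch
  (periodic 78 14 5) (periodic 87 6 2) (periodic 87 6 2)) (branch (uniform (nonRich 86 8))
  (periodic 57 37 13) (periodic 57 37 13))) (nonRich 77 13)) (periodic 82 6 2) (periodic 82 6 2))
  (branch (uniform (nonRich 81 8)) (branch (branch (uniform (periodic 89 3 1))
  (uniform (periodic 70 23 8)) (nonRich 85 8)) (uniform (periodic 86 6 2)) (branch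
  (uniform (nonRich 81 13)) (branch (branch (periodic 0 96 34) (periodic 0 96 34) (nonRich 90 8))
  (periodic 82 14 5) (periodic 82 14 5)) (branch (uniform (nonRich 81 16)) (periodic 88 9 3)
  (periodic 88 9 3)))) (branch (uniform (nonRich 81 11)) (periodic 83 9 3) (periodic 83 9 3))))
  (nonRich 77 8)) (nonRich 52 31) (nonRich 52 31)) (branch (uniform (nonRich 73 11))
  (periodic 75 9 3) (periodic 75 9 3)))) (nonRich 64 13)) (periodic 69 6 2) (periodic 69 6 2))
  (branch (uniform (nonRich 68 8)) (periodic 53 23 8) (periodic 53 23 8))) (nonRich 64 8))
  (uniform (periodic 65 6 2)) (branch (uniform (nonRich 60 13)) (branch (branch
  (uniform (periodic 73 3 1)) (uniform (periodic 40 37 13)) (nonRich 69 8)) (periodic 61 14 5)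
  (periodic 61 14 5)) (branch (uniform (nonRich 60 16)) (periodic 67 9 3) (periodic 67 9 3))))
  (branch (uniform (nonRich 60 11)) (periodic 62 9 3) (periodic 62 9 3)))) (nonRich 56 8))
  (periodic 48 14 5) (periodic 48 14 5)) (branch (uniform (nonRich 47 16)) (periodic 54 9 3)
  (periodic 54 9 3)))) (branch (uniform (nonRich 47 11)) (periodic 49 9 3) (periodic 49 9 3))))
  (nonRich 43 8)) (nonRich 18 31) (nonRich 18 31)) (branch (uniform (nonRich 39 11))
  (periodic 41 9 3) (periodic 41 9 3)))) (nonRich 30 13)) (periodic 35 6 2) (periodic 35 6 2))
  (branch (uniform (nonRich 34 8)) (periodic 19 23 8) (periodic 19 23 8))) (nonRich 30 8))
  (uniform (periodic 31 6 2)) (branch (uniform (nonRich 26 13)) (branch (branch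
  (uniform (periodic 39 3 1)) (uniform (periodic 6 37 13)) (nonRich 35 8)) (periodic 27 14 5)
  (periodic 27 14 5)) (branch (uniform (nonRich 26 16)) (periodic 33 9 3) (periodic 33 9 3))))
  (branch (uniform (nonRich 26 11)) (periodic 28 9 3) (periodic 28 9 3)))) (nonRich 22 8))
  (periodic 14 14 5) (periodic 14 14 5)) (branch (uniform (nonRich 13 16)) (periodic 20 9 3)
  (periodic 20 9 3)))) (branch (uniform (nonRich 13 11)) (periodic 15 9 3) (periodic 15 9 3))))
  (nonRich 9 8)) (uniform (periodic 10 6 2)) (branch (uniform (nonRich 5 13)) (branch (branch
  (uniform (periodic 18 3 1)) (branch (branch (uniform (periodic 21 3 1))
  (uniform (periodic 16 9 3)) (nonRich 14 11)) (branch (returns 𝟏) (periodic 19 6 2)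
  (periodic 19 6 2)) (branch (uniform (nonRich 18 8)) (branch (branch (uniform (periodic 26 3 1))
  (branch (branch (uniform (periodic 29 3 1)) (uniform (periodic 24 9 3)) (nonRich 22 11)) (branch
  (nonRich 1 31) (periodic 27 6 2) (periodic 27 6 2)) (branch (uniform (nonRich 26 8))
  (periodic 11 23 8) (periodic 11 23 8))) (nonRich 22 8)) (uniform (periodic 23 6 2)) (branch
  (uniform (nonRich 18 13)) (branch (branch (uniform (periodic 31 3 1)) (branch (branch
  (uniform (periodic 34 3 1)) (uniform (periodic 29 9 3)) (nonRich 27 11)) (branch (returns 𝟐)
  (periodic 32 6 2) (periodic 32 6 2)) (branch (uniform (nonRich 31 8)) (periodic 2 37 13)
  (periodic 2 37 13))) (nonRich 27 8)) (periodic 19 14 5) (periodic 19 14 5)) (branch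
  (uniform (nonRich 18 16)) (periodic 25 9 3) (periodic 25 9 3)))) (branch
  (uniform (nonRich 18 11)) (periodic 20 9 3) (periodic 20 9 3)))) (nonRich 14 8))
  (periodic 6 14 5) (periodic 6 14 5)) (branch (uniform (nonRich 5 16)) (periodic 12 9 3)
  (periodic 12 9 3)))) (branch (uniform (nonRich 5 11)) (periodic 7 9 3) (periodic 7 9 3))))
  (branch (branch (uniform (periodic 9 3 1)) (branch (branch (uniform (periodic 12 3 1)) (branch
  (uniform (periodic 8 9 3)) (nonRich 2 15) (nonRich 7 11)) (branch (branch
  (uniform (periodic 16 3 1)) (branch (branch (uniform (periodic 19 3 1)) (branch
  (uniform (periodic 15 9 3)) (nonRich 2 22) (nonRich 14 11)) (periodic 3 20 7)) (branch (branch
  (uniform (periodic 21 3 1)) (branch (branch (nonRich 9 17) (nonRich 9 17) (nonRich 14 14))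
  (branch (branch (uniform (periodic 26 3 1)) (periodic 15 14 5) (periodic 15 14 5))
  (periodic 22 6 2) (periodic 22 6 2)) (nonRich 14 13)) (branch (branch (uniform (periodic 25 3 1))
  (branch (branch (uniform (periodic 28 3 1)) (branch (uniform (periodic 24 9 3)) (nonRich 18 15)
  (nonRich 23 11)) (branch (branch (uniform (periodic 32 3 1)) (branch (branch
  (uniform (periodic 35 3 1)) (branch (uniform (periodic 31 9 3)) (nonRich 18 22) (nonRich 30 11))
  (periodic 19 20 7)) (branch (branch (uniform (periodic 37 3 1)) (branch (branch (nonRich 25 17)
  (nonRich 25 17) (nonRich 30 14)) (branch (branch (uniform (periodic 42 3 1)) (periodic 31 14 5)
  (periodic 31 14 5)) (periodic 38 6 2) (periodic 38 6 2)) (nonRich 30 13)) (branch (branch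
  (uniform (periodic 41 3 1)) (branch (periodic 0 45 16) (periodic 0 45 16) (nonRich 39 8)) (branch
  (branch (uniform (periodic 45 3 1)) (periodic 36 12 4) (periodic 36 12 4)) (nonRich 34 13)
  (nonRich 34 13))) (nonRich 34 9) (nonRich 34 9))) (periodic 33 6 2) (periodic 33 6 2))
  (nonRich 30 8)) (branch (branch (uniform (periodic 36 3 1)) (periodic 27 12 4)
  (periodic 27 12 4)) (nonRich 18 20) (nonRich 18 20))) (nonRich 18 16) (nonRich 18 16))) (branch
  (branch (uniform (periodic 30 3 1)) (branch (branch (nonRich 9 26) (nonRich 9 26)
  (nonRich 23 14)) (branch (branch (uniform (periodic 35 3 1)) (periodic 24 14 5)
  (periodic 24 14 5)) (periodic 31 6 2) (periodic 31 6 2)) (nonRich 23 13)) (branch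
  (uniform (periodic 10 26 9)) (nonRich 27 9) (nonRich 27 9))) (periodic 26 6 2) (periodic 26 6 2))
  (nonRich 23 8)) (branch (branch (uniform (periodic 29 3 1)) (periodic 20 12 4)
  (periodic 20 12 4)) (nonRich 18 13) (nonRich 18 13))) (nonRich 18 9) (nonRich 18 9)))
  (periodic 17 6 2) (periodic 17 6 2)) (nonRich 14 8)) (branch (branch (uniform (periodic 20 3 1))
  (periodic 11 12 4) (periodic 11 12 4)) (nonRich 2 20) (nonRich 2 20))) (nonRich 2 16)
  (nonRich 2 16))) (branch (branch (uniform (periodic 14 3 1)) (branch (branch
  (uniform (periodic 17 3 1)) (uniform (periodic 12 9 3)) (nonRich 7 14)) (branch (branch
  (uniform (periodic 19 3 1)) (periodic 8 14 5) (periodic 8 14 5)) (periodic 15 6 2)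
  (periodic 15 6 2)) (nonRich 7 13)) (branch (branch (uniform (periodic 18 3 1)) (branch (branch
  (uniform (periodic 21 3 1)) (branch (uniform (periodic 17 9 3)) (nonRich 11 15) (nonRich 16 11))
  (branch (branch (uniform (periodic 25 3 1)) (branch (branch (uniform (periodic 28 3 1)) (branch
  (uniform (periodic 24 9 3)) (nonRich 11 22) (nonRich 23 11)) (periodic 12 20 7)) (branch (branch
  (uniform (periodic 30 3 1)) (branch (branch (nonRich 18 17) (nonRich 18 17) (nonRich 23 14))
  (branch (branch (uniform (periodic 35 3 1)) (periodic 24 14 5) (periodic 24 14 5))
  (periodic 31 6 2) (periodic 31 6 2)) (nonRich 23 13)) (branch (branch (uniform (periodic 34 3 1))
  (branch (branch (uniform (periodic 37 3 1)) (branch (uniform (periodic 33 9 3)) (nonRich 27 15)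
  (nonRich 32 11)) (branch (branch (uniform (periodic 41 3 1)) (branch (branch
  (uniform (periodic 44 3 1)) (branch (uniform (periodic 40 9 3)) (nonRich 27 22) (nonRich 39 11))
  (periodic 28 20 7)) (branch (uniform (periodic 3 45 16)) (periodic 42 6 2) (periodic 42 6 2))
  (nonRich 39 8)) (branch (branch (uniform (periodic 45 3 1)) (periodic 36 12 4)
  (periodic 36 12 4)) (nonRich 27 20) (nonRich 27 20))) (nonRich 27 16) (nonRich 27 16))) (branch
  (branch (uniform (periodic 39 3 1)) (branch (branch (nonRich 18 26) (nonRich 18 26)
  (nonRich 32 14)) (branch (branch (uniform (periodic 44 3 1)) (periodic 33 14 5)
  (periodic 33 14 5)) (periodic 40 6 2) (periodic 40 6 2)) (nonRich 32 13)) (branch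
  (uniform (periodic 19 26 9)) (nonRich 36 9) (nonRich 36 9))) (periodic 35 6 2) (periodic 35 6 2))
  (nonRich 32 8)) (branch (branch (uniform (periodic 38 3 1)) (periodic 29 12 4)
  (periodic 29 12 4)) (nonRich 27 13) (nonRich 27 13))) (nonRich 27 9) (nonRich 27 9)))
  (periodic 26 6 2) (periodic 26 6 2)) (nonRich 23 8)) (branch (branch (uniform (periodic 29 3 1))
  (periodic 20 12 4) (periodic 20 12 4)) (nonRich 11 20) (nonRich 11 20))) (nonRich 11 16)
  (nonRich 11 16))) (branch (branch (uniform (periodic 23 3 1)) (periodic 0 26 9)
  (periodic 0 26 9)) (periodic 19 6 2) (periodic 19 6 2)) (nonRich 16 8)) (branch (branch
  (uniform (periodic 22 3 1)) (periodic 13 12 4) (periodic 13 12 4)) (nonRich 11 13)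
  (nonRich 11 13))) (nonRich 11 9) (nonRich 11 9))) (periodic 10 6 2) (periodic 10 6 2))
  (nonRich 7 8)) (branch (branch (uniform (periodic 13 3 1)) (periodic 4 12 4) (periodic 4 12 4))
  (nonRich 2 13) (nonRich 2 13))) (nonRich 2 9) (nonRich 2 9))

certificate-valid : Valid f (g ∘ᵐ h) 𝟎𝟏𝟏𝟎 𝟎𝟏𝟏𝟎 certificate
certificate-valid = toWitness {a? = valid? f (g ∘ᵐ h) 𝟎𝟏𝟏𝟎 𝟎𝟏𝟏𝟎 certificate} tt

lemma9 : (u : InfWord 3) → (fu : InfWord 2) → IsImage f u fu → Good fu →
    Contains u (𝟎 ∷ 𝟏 ∷ 𝟏 ∷ 𝟎 ∷ []) →
    ∃ λ k → Σ[ W ∈ InfWord 3 ] IsImage g W (suffix u k) ×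
      (∃ λ m → Σ[ U ∈ InfWord 3 ] IsImage h U (suffix W m))
lemma9 u fu img (rich , free) (i , start) =
  let U , gh[U]≡u = returns⇒suffix-isImage (g ∘ᵐ h) u 𝟎𝟏𝟏𝟎 next i start
  in i , image h U , isImage-∘ᵐ g h h-nonErasing gh[U]≡u , 0 , U , image-isImage h h-nonErasing U
  where
  next : ∀ q → OccursAt u q 𝟎𝟏𝟏𝟎 → Σ[ c ∈ Fin 3 ] OccursAt u q ((g ∘ᵐ h) c ++ 𝟎𝟏𝟏𝟎)
  next = valid⇒returns f (g ∘ᵐ h) 𝟎𝟏𝟏𝟎 img rich free 𝟎𝟏𝟏𝟎 certificate certificate-valid
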